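{- Let $m,n\ge 1$ and let $K_{m,n}$ be the complete bipartite graph with parts of sizes $m$ and $n$. Let $P$ be a vertex of degree $n$ (i.e. a vertex in the part of size $m$). Then \[H_r(P)=n\mathbb{N}\cup\big((m-1)n+\mathbb{N}\big).\]
   Context: $\mathbb{N}=\{0,1,2,\dots\}$, $n\mathbb{N}=\{nk:k\in\mathbb{N}\}$, $a+\mathbb{N}=\{a+k:k\in\mathbb{N}\}$. A divisor on a graph $G$ is a formal integer combination $D=\sum_{Q\in V(G)}D(Q)\,Q$; $\deg D=\sum_Q D(Q)$; effective means all coefficients $\ge0$. For $f:V(G)\to\mathbb{Z}$, $\Delta f$ is the divisor with $\Delta f(Q)=\sum_{e=QR\in E(G)}(f(Q)-f(R))$. $|D|=\{E\ge 0:E-D=\Delta f\text{ for some }f\}$. The rank $r(D)$ is $-1$ if $|D|=\emptyset$, and otherwise the largest $k\ge 0$ such that $|D-E|\neq\emptyset$ for every effective divisor $E$ of degree $k$. For $P\in V(G)$, $H_r(P)=\{k\in\mathbb{N}: r(kP)>r((k-1)P)\}$. -}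

module Defs where

open import Data.Nat as ℕ using (ℕ; zero; suc)
open import Data.Integer as ℤ using (ℤ; +_; -[1+_]; _-_; _+_; _*_; _≤_; _<_)
open import Data.Fin as Fin using (Fin)
open import Data.Sum.Properties using (≡-dec)
open import Data.Empty using (⊥)
open import Relation.Nullary using (yes; no)
open import Data.List using (List; []; _∷_; map; allFin; foldr; _++_)
open import Data.Sum using (_⊎_; inj₁; inj₂)
open import Data.Product using (Σ; ∃; _×_; _,_)
open import Relation.Binary.PropositionalEquality using (_≡_; _≢_)
open import Relation.Nullary using (¬_)

V : ℕ → ℕ → Set
V m n = Fin m ⊎ Fin n

sumℤ : List ℤ → ℤ
sumℤ = foldr _+_ (+ 0)

vertices : (m n : ℕ) → List (V m n)
vertices m n = map inj₁ (allFin m) ++ map inj₂ (allFin n)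

neighbours : {m n : ℕ} → V m n → List (V m n)
neighbours {m} {n} (inj₁ i) = map inj₂ (allFin n)
neighbours {m} {n} (inj₂ j) = map inj₁ (allFin m)

Divisor : ℕ → ℕ → Set
Divisor m n = V m n → ℤ

deg : {m n : ℕ} → Divisor m n → ℤ
deg {m} {n} D = sumℤ (map D (vertices m n))

Effective : {m n : ℕ} → Divisor m n → Set
Effective D = ∀ Q → + 0 ≤ D Q

_⊝_ : {m n : ℕ} → Divisor m n → Divisor m n → Divisor m n
(D ⊝ E) Q = D Q - E Q

Δ : {m n : ℕ} → (V m n → ℤ) → Divisor m n
Δ f Q = sumℤ (map (λ R → f Q - f R) (neighbours Q))

InLinSys : {m n : ℕ} → Divisor m n → Divisor m n → Set
InLinSys {m} {n} D E = Effective E × ∃ λ (f : V m n → ℤ) → ∀ Q → E Q - D Q ≡ Δ f Q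

LinSysNonempty : {m n : ℕ} → Divisor m n → Set
LinSysNonempty D = ∃ λ E → InLinSys D E

RankCond : {m n : ℕ} → Divisor m n → ℕ → Set
RankCond D k = ∀ E → Effective E → deg E ≡ + k → LinSysNonempty (D ⊝ E)

-- r(D) = r  (rank as a relation; r(D) = -1 iff |D| = ∅,
-- otherwise r(D) is the largest k ≥ 0 satisfying RankCond)
IsRank : {m n : ℕ} → Divisor m n → ℤ → Set
IsRank D -[1+ zero ]    = ¬ LinSysNonempty D
IsRank D -[1+ suc _ ]   = ⊥
IsRank D (+ k) = LinSysNonempty D × RankCond D k × (∀ j → k ℕ.< j → ¬ RankCond D j)

_·_ : {m n : ℕ} → ℤ → V m n → Divisor m n
(k · P) Q with ≡-dec Fin._≟_ Fin._≟_ P Q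
... | yes _ = k
... | no _  = + 0

-- H_r(P) = { k ∈ ℕ : r(kP) > r((k-1)P) }, with (k-1)P computed in ℤ (so k = 0 gives -P)
InHr : {m n : ℕ} → V m n → ℕ → Set
InHr P k = ∃ λ r₁ → ∃ λ r₂ → IsRank ((+ k) · P) r₁ × IsRank ((+ k - + 1) · P) r₂ × r₂ < r₁

InTarget : ℕ → ℕ → ℕ → Set
InTarget m n k = (∃ λ t → k ≡ n ℕ.* t) ⊎ (∃ λ t → k ≡ (m ℕ.∸ 1) ℕ.* n ℕ.+ t)

module Submission where

-- Write k = nq + ρ with 0 ≤ ρ < n and let g = (m − 1)(n − 1).  Firing the m-side of K_{m,n}
-- gives r(kP) ≥ q whenever nq ≤ k.  Every divisor of degree at least g has an effective
-- representative: order the m-side by the residues of D modulo n, fire one explicit function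
-- for each choice of a distinguished vertex, and average over the m choices; so r(kP) ≥ k − g.
-- Conversely, removing eP and q + 1 further points of the m-side from kP and firing once more
-- leaves a divisor negative at one vertex, nonpositive on the n-side and below n on the m-side,
-- and such a divisor has no effective representative (compare the minima of any firing function
-- on the two sides).  Hence r(kP) = q for k < (m − 1)n and r(kP) = k − g beyond, which increases
-- exactly at the multiples of n and at every k ≥ (m − 1)n.

open import Defs
open import Data.Nat as ℕ using (ℕ; zero; suc; z≤n; s≤s)
import Data.Nat.Properties as ℕP
import Data.Nat.DivMod as ℕDM
open import Data.Nat.DivMod using (_/_; _%_)
open import Data.Integer as ℤ using (ℤ; +_; -[1+_]; _+_; _-_; _*_; -_; _≤_; _<_; +≤+; +<+; _/ℕ_; _%ℕ_)
open import Data.Integer.DivMod using (n%ℕd<d; a≡a%ℕn+[a/ℕn]*n)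
import Data.Integer.Properties as ℤP
open import Data.Integer.Tactic.RingSolver using (solve-∀)
import Data.Nat.Tactic.RingSolver as ℕSolver
open import Data.Fin as Fin using (Fin; toℕ; punchIn; punchOut)
import Data.Fin.Properties as FinP
open import Data.Fin.Permutation as Perm using (Permutation; _⟨$⟩ʳ_; _⟨$⟩ˡ_)
import Data.Fin.Permutation.Components as PC
open import Data.List as List using (List; []; _∷_; allFin; tabulate)
import Data.List.Properties as ListP
open import Data.Sum using (inj₁; inj₂)
open import Data.Sum.Properties using (≡-dec; inj₁-injective; inj₂-injective)
open import Data.Product using (∃; _×_; _,_; proj₁; proj₂)
open import Function using (_∘_; id)
open import Function.Definitions using (Injective)
open import Relation.Nullary using (¬_; Dec; yes; no)
open import Relation.Nullary.Negation using (contradiction)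
open import Relation.Binary.PropositionalEquality
open import Relation.Binary.Definitions using (tri<; tri≈; tri>)
open import Algebra.Properties.Semiring.Sum ℤP.+-*-semiring
  using (sum; sum-syntax; ∑-distrib-+; ∑-comm; sum-remove; sum-cong-≗; sum-replicate-zero; ∑-permute; *-distribʳ-sum)

∑-const : ∀ k c → ∑[ _ < k ] c ≡ + k * c
∑-const zero    c = sym (ℤP.*-zeroˡ c)
∑-const (suc k) c = begin
  c + ∑[ _ < k ] c  ≡⟨ cong (_+_ c) (∑-const k c) ⟩
  c + + k * c       ≡⟨ sym (ℤP.suc-* (+ k) c) ⟩
  + suc k * c       ∎
  where open ≡-Reasoning

∑-neg : ∀ {k} (f : Fin k → ℤ) → ∑[ i < k ] (- f i) ≡ - sum f
∑-neg {zero}  f = refl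
∑-neg {suc k} f = trans (cong (_+_ (- f Fin.zero)) (∑-neg (f ∘ Fin.suc))) (sym (ℤP.neg-distrib-+ (f Fin.zero) _))

∑-distrib-- : ∀ {k} (f g : Fin k → ℤ) → ∑[ i < k ] (f i - g i) ≡ sum f - sum g
∑-distrib-- f g = trans (∑-distrib-+ f (-_ ∘ g)) (cong (_+_ (sum f)) (∑-neg g))

∑-mono-≤ : ∀ {k} {f g : Fin k → ℤ} → (∀ i → f i ≤ g i) → sum f ≤ sum g
∑-mono-≤ {zero}  f≤g = ℤP.≤-refl
∑-mono-≤ {suc k} f≤g = ℤP.+-mono-≤ (f≤g Fin.zero) (∑-mono-≤ (f≤g ∘ Fin.suc))

∑-nonpos : ∀ {k} {f : Fin k → ℤ} → (∀ i → f i ≤ + 0) → sum f ≤ + 0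
∑-nonpos {k} f≤0 = ℤP.≤-trans (∑-mono-≤ f≤0) (ℤP.≤-reflexive (sum-replicate-zero k))

∑-nonneg : ∀ {k} {f : Fin k → ℤ} → (∀ i → + 0 ≤ f i) → + 0 ≤ sum f
∑-nonneg {k} 0≤f = ℤP.≤-trans (ℤP.≤-reflexive (sym (sum-replicate-zero k))) (∑-mono-≤ 0≤f)

∑-≤-const : ∀ {k} {f : Fin k → ℤ} c → (∀ i → f i ≤ c) → sum f ≤ + k * c
∑-≤-const {k} c f≤c = ℤP.≤-trans (∑-mono-≤ f≤c) (ℤP.≤-reflexive (∑-const k c))

∑-≥-const : ∀ {k} {f : Fin k → ℤ} c → (∀ i → c ≤ f i) → + k * c ≤ sum f
∑-≥-const {k} c c≤f = ℤP.≤-trans (ℤP.≤-reflexive (sym (∑-const k c))) (∑-mono-≤ c≤f)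

∑-nonpos-≤-term : ∀ {k} {f : Fin k → ℤ} → (∀ i → f i ≤ + 0) → ∀ j → sum f ≤ f j
∑-nonpos-≤-term {suc k} {f} f≤0 j = begin
  sum f                               ≡⟨ sum-remove {i = j} f ⟩
  f j + sum (f ∘ punchIn j)           ≤⟨ ℤP.+-monoʳ-≤ (f j) (∑-nonpos (f≤0 ∘ punchIn j)) ⟩
  f j + + 0                           ≡⟨ ℤP.+-identityʳ (f j) ⟩
  f j                                 ∎
  where open ℤP.≤-Reasoning

∑-nonneg-≥-term : ∀ {k} {f : Fin k → ℤ} → (∀ i → + 0 ≤ f i) → ∀ j → f j ≤ sum f
∑-nonneg-≥-term {suc k} {f} 0≤f j = begin
  f j                                 ≡⟨ ℤP.+-identityʳ (f j) ⟨
  f j + + 0                           ≤⟨ ℤP.+-monoʳ-≤ (f j) (∑-nonneg (0≤f ∘ punchIn j)) ⟩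
  f j + sum (f ∘ punchIn j)           ≡⟨ sum-remove {i = j} f ⟨
  sum f                               ∎
  where open ℤP.≤-Reasoning

∑-single : ∀ {k} (f : Fin k → ℤ) j → (∀ i → j ≢ i → f i ≡ + 0) → sum f ≡ f j
∑-single {suc k} f j f≡0 = begin
  sum f                      ≡⟨ sum-remove {i = j} f ⟩
  f j + sum (f ∘ punchIn j)  ≡⟨ cong (_+_ (f j)) (trans (sum-cong-≗ (λ i → f≡0 _ (FinP.punchInᵢ≢i j i ∘ sym)))
                                                    (sum-replicate-zero k)) ⟩
  f j + + 0                  ≡⟨ ℤP.+-identityʳ (f j) ⟩
  f j                        ∎
  where open ≡-Reasoning

∑<k⇒∃≤0 : ∀ {k} (f : Fin k → ℤ) → sum f < + k → ∃ λ i → f i ≤ + 0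
∑<k⇒∃≤0 {k} f ∑f<k with FinP.any? (λ i → f i ℤP.≤? + 0)
... | yes found = found
... | no  none  = contradiction (∑-≥-const (+ 1) (λ i → ℤP.i<j⇒suc[i]≤j (ℤP.≰⇒> λ fi≤0 → none (i , fi≤0))))
                               (ℤP.<⇒≱ (subst (sum f <_) (sym (ℤP.*-identityʳ (+ k))) ∑f<k))

∑-mono-< : ∀ {k} {f g : Fin k → ℤ} → (∀ i → f i ≤ g i) → ∀ j → f j < g j → sum f < sum g
∑-mono-< {suc k} {f} {g} f≤g j fj<gj = begin-strict
  sum f                       ≡⟨ sum-remove {i = j} f ⟩
  f j + sum (f ∘ punchIn j)   <⟨ ℤP.+-mono-<-≤ fj<gj (∑-mono-≤ (f≤g ∘ punchIn j)) ⟩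
  g j + sum (g ∘ punchIn j)   ≡⟨ sum-remove {i = j} g ⟨
  sum g                       ∎
  where open ℤP.≤-Reasoning

argmin : ∀ {k} (f : Fin (suc k) → ℤ) → ∃ λ i → ∀ j → f i ≤ f j
argmin {zero}  f = Fin.zero , λ { Fin.zero → ℤP.≤-refl }
argmin {suc k} f with argmin (f ∘ Fin.suc)
... | i , fi≤ with f Fin.zero ℤP.≤? f (Fin.suc i)
...   | yes f0≤fi = Fin.zero , λ { Fin.zero → ℤP.≤-refl ; (Fin.suc j) → ℤP.≤-trans f0≤fi (fi≤ j) }
...   | no  f0≰fi = Fin.suc i , λ { Fin.zero → ℤP.<⇒≤ (ℤP.≰⇒> f0≰fi) ; (Fin.suc j) → fi≤ j }

0≤pos* : ∀ k {x} → + 0 ≤ x → + 0 ≤ + k * x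
0≤pos* k {x} 0≤x = subst (_≤ + k * x) (ℤP.*-zeroʳ (+ k)) (ℤP.*-monoˡ-≤-nonNeg (+ k) 0≤x)

i<j⇒i-j≤-1 : ∀ {i j} → i < j → i - j ≤ -[1+ 0 ]
i<j⇒i-j≤-1 {i} {j} i<j = begin
  i - j                         ≡⟨ regroup i j ⟩
  (+ 1 + i - j) + -[1+ 0 ]      ≤⟨ ℤP.+-monoˡ-≤ -[1+ 0 ] (ℤP.i≤j⇒i-j≤0 (ℤP.i<j⇒suc[i]≤j i<j)) ⟩
  -[1+ 0 ]                      ∎
  where
  open ℤP.≤-Reasoning
  regroup : ∀ x y → x - y ≡ (+ 1 + x - y) + -[1+ 0 ]
  regroup = solve-∀

𝟙 : {A : Set} → Dec A → ℤ
𝟙 (yes _) = + 1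
𝟙 (no _)  = + 0

𝟙-yes : {A : Set} (d : Dec A) → A → 𝟙 d ≡ + 1
𝟙-yes (yes _) _ = refl
𝟙-yes (no ¬a) a = contradiction a ¬a

𝟙-no : {A : Set} (d : Dec A) → ¬ A → 𝟙 d ≡ + 0
𝟙-no (yes a) ¬a = contradiction a ¬a
𝟙-no (no _)  _  = refl

𝟙-nonneg : {A : Set} (d : Dec A) → + 0 ≤ 𝟙 d
𝟙-nonneg (yes _) = +≤+ z≤n
𝟙-nonneg (no _)  = +≤+ z≤n

𝟙-≤1 : {A : Set} (d : Dec A) → 𝟙 d ≤ + 1
𝟙-≤1 (yes _) = +≤+ (s≤s z≤n)
𝟙-≤1 (no _)  = +≤+ z≤n

𝟙-mono : {A B : Set} (d : Dec A) (d' : Dec B) → (A → B) → 𝟙 d ≤ 𝟙 d'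
𝟙-mono (yes a) d' A→B = ℤP.≤-reflexive (sym (𝟙-yes d' (A→B a)))
𝟙-mono (no _)  d' A→B = 𝟙-nonneg d'

𝟙-cong : {A B : Set} (d : Dec A) (d' : Dec B) → (A → B) → (B → A) → 𝟙 d ≡ 𝟙 d'
𝟙-cong d d' A→B B→A = ℤP.≤-antisym (𝟙-mono d d' A→B) (𝟙-mono d' d B→A)

count-< : ∀ {k} c → c ℕ.≤ k → ∑[ t < k ] 𝟙 (toℕ t ℕ.<? c) ≡ + c
count-< {zero}  zero    _         = refl
count-< {suc k} zero    _         = sum-replicate-zero (suc k)
count-< {suc k} (suc c) (s≤s c≤k) = cong (_+_ (+ 1)) (trans shift (count-< c c≤k))
  where
  shift : ∑[ t < k ] 𝟙 (toℕ (Fin.suc t) ℕ.<? suc c) ≡ ∑[ t < k ] 𝟙 (toℕ t ℕ.<? c)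
  shift = sum-cong-≗ {k} λ t → 𝟙-cong (toℕ (Fin.suc t) ℕ.<? suc c) (toℕ t ℕ.<? c) ℕ.s<s⁻¹ ℕ.s<s

injective⇒surjective : ∀ {k} {π : Fin k → Fin k} → Injective _≡_ _≡_ π → ∀ t → ∃ λ a → π a ≡ t
injective⇒surjective {suc k} {π} π-inj t with FinP.any? (λ a → π a FinP.≟ t)
... | yes hit = hit
... | no  miss = contradiction (FinP.injective⇒≤ punchOut∘π-injective) ℕP.1+n≰n
  where
  π≢t : ∀ a → t ≢ π a
  π≢t a e = miss (a , sym e)
  punchOut∘π-injective : Injective _≡_ _≡_ (λ a → punchOut (π≢t a))
  punchOut∘π-injective e = π-inj (FinP.punchOut-injective (π≢t _) (π≢t _) e)

injective⇒permutation : ∀ {k} (π : Fin k → Fin k) → Injective _≡_ _≡_ π → Permutation k k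
injective⇒permutation π π-inj = Perm.permutation π (proj₁ ∘ surj) (proj₂ ∘ surj) (λ a → π-inj (proj₂ (surj (π a))))
  where
  surj : ∀ t → ∃ λ a → π a ≡ t
  surj = injective⇒surjective π-inj

transpose-self : ∀ {k} (j l : Fin k) → PC.transpose j l j ≡ l
transpose-self j l with j FinP.≟ j
... | yes _   = refl
... | no  j≢j = contradiction refl j≢j

∑-reindex : ∀ {k} (π : Fin k → Fin k) → Injective _≡_ _≡_ π → (f : Fin k → ℤ) → ∑[ a < k ] f (π a) ≡ sum f
∑-reindex π π-inj f = sym (∑-permute f (injective⇒permutation π π-inj))

module Ranking {k N : ℕ} (key : Fin k → Fin N) (key-injective : Injective _≡_ _≡_ key) where

  #larger : Fin k → ℤ
  #larger a' = ∑[ a < k ] 𝟙 (key a' FinP.<? key a)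

  #larger-nonneg : ∀ a' → + 0 ≤ #larger a'
  #larger-nonneg a' = ∑-nonneg λ a → 𝟙-nonneg (key a' FinP.<? key a)

  #larger<k : ∀ a' → #larger a' < + k
  #larger<k a' = subst (#larger a' <_) (trans (∑-const k (+ 1)) (ℤP.*-identityʳ (+ k)))
    (∑-mono-< (λ a → 𝟙-≤1 (key a' FinP.<? key a)) a'
      (ℤP.≤-<-trans (ℤP.≤-reflexive (𝟙-no (key a' FinP.<? key a') (FinP.<-irrefl refl))) (+<+ (s≤s z≤n))))

  #larger-antitone : ∀ {a a'} → key a Fin.< key a' → #larger a' < #larger a
  #larger-antitone {a} {a'} ka<ka' =
    ∑-mono-< (λ x → 𝟙-mono (key a' FinP.<? key x) (key a FinP.<? key x) (FinP.<-trans ka<ka')) a'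
      (ℤP.≤-<-trans (ℤP.≤-reflexive (𝟙-no (key a' FinP.<? key a') (FinP.<-irrefl refl)))
                    (ℤP.<-≤-trans (+<+ (s≤s z≤n)) (ℤP.≤-reflexive (sym (𝟙-yes (key a FinP.<? key a') ka<ka')))))

  #larger-injective : Injective _≡_ _≡_ #larger
  #larger-injective {a} {a'} eq with FinP.<-cmp (key a) (key a')
  ... | tri< ka<ka' _ _ = contradiction (#larger-antitone ka<ka') (ℤP.<-irrefl (sym eq))
  ... | tri≈ _ ka≡ka' _ = key-injective ka≡ka'
  ... | tri> _ _ ka'<ka = contradiction (#larger-antitone ka'<ka) (ℤP.<-irrefl eq)

  ∑-atLeast : ∀ a' → ∑[ a < k ] 𝟙 (key a' FinP.≤? key a) ≡ + 1 + #larger a'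
  ∑-atLeast a' = begin
    ∑[ a < k ] 𝟙 (key a' FinP.≤? key a)
      ≡⟨ sum-cong-≗ {k} split ⟩
    ∑[ a < k ] (𝟙 (a' FinP.≟ a) + 𝟙 (key a' FinP.<? key a))
      ≡⟨ ∑-distrib-+ (λ a → 𝟙 (a' FinP.≟ a)) (λ a → 𝟙 (key a' FinP.<? key a)) ⟩
    (∑[ a < k ] 𝟙 (a' FinP.≟ a)) + #larger a'
      ≡⟨ cong (_+ #larger a') (trans (∑-single _ a' λ a a'≢a → 𝟙-no (a' FinP.≟ a) a'≢a)
                                     (𝟙-yes (a' FinP.≟ a') refl)) ⟩
    + 1 + #larger a'
      ∎
    where
    open ≡-Reasoning
    split : ∀ a → 𝟙 (key a' FinP.≤? key a) ≡ 𝟙 (a' FinP.≟ a) + 𝟙 (key a' FinP.<? key a)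
    split a with a' FinP.≟ a
    ... | yes refl = trans (𝟙-yes (key a' FinP.≤? key a') FinP.≤-refl)
                           (cong (_+_ (+ 1)) (sym (𝟙-no (key a' FinP.<? key a') (FinP.<-irrefl refl))))
    ... | no a'≢a  = trans (𝟙-cong (key a' FinP.≤? key a) (key a' FinP.<? key a)
                                   (λ ka'≤ka → FinP.≤∧≢⇒< ka'≤ka (a'≢a ∘ key-injective)) ℕP.<⇒≤)
                           (sym (ℤP.+-identityˡ _))

  position : Fin k → Fin k
  position a' = Fin.fromℕ< (ℤP.drop‿+<+ (subst (_< + k) (sym (ℤP.0≤i⇒+∣i∣≡i (#larger-nonneg a'))) (#larger<k a')))

  toℕ-position : ∀ a' → + toℕ (position a') ≡ #larger a'
  toℕ-position a' = trans (cong +_ (FinP.toℕ-fromℕ< _)) (ℤP.0≤i⇒+∣i∣≡i (#larger-nonneg a'))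

  position-injective : Injective _≡_ _≡_ position
  position-injective {a} {a'} eq = #larger-injective (trans (sym (toℕ-position a)) (trans (cong (+_ ∘ toℕ) eq) (toℕ-position a')))

  count-position< : ∀ s → s ℕ.≤ k → ∑[ a' < k ] 𝟙 (toℕ (position a') ℕ.<? s) ≡ + s
  count-position< s s≤k = trans (∑-reindex position position-injective (λ t → 𝟙 (toℕ t ℕ.<? s))) (count-< s s≤k)

sumℤ-++ : (xs ys : List ℤ) → sumℤ (xs List.++ ys) ≡ sumℤ xs + sumℤ ys
sumℤ-++ []       ys = sym (ℤP.+-identityˡ (sumℤ ys))
sumℤ-++ (x ∷ xs) ys = trans (cong (_+_ x) (sumℤ-++ xs ys)) (sym (ℤP.+-assoc x (sumℤ xs) (sumℤ ys)))

sumℤ-map-map-tabulate : ∀ {k} {A B : Set} (h : B → ℤ) (g : A → B) (t : Fin k → A) →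
                        sumℤ (List.map h (List.map g (tabulate t))) ≡ ∑[ a < k ] h (g (t a))
sumℤ-map-map-tabulate {zero}  h g t = refl
sumℤ-map-map-tabulate {suc k} h g t = cong (_+_ (h (g (t Fin.zero)))) (sumℤ-map-map-tabulate h g (t ∘ Fin.suc))

sumℤ-map-+ : {A : Set} (g h : A → ℤ) (xs : List A) →
             sumℤ (List.map (λ x → g x + h x) xs) ≡ sumℤ (List.map g xs) + sumℤ (List.map h xs)
sumℤ-map-+ g h []       = refl
sumℤ-map-+ g h (x ∷ xs) = trans (cong (_+_ (g x + h x)) (sumℤ-map-+ g h xs)) (interchange (g x) (h x) _ _)
  where
  interchange : ∀ a b c d → (a + b) + (c + d) ≡ (a + c) + (b + d)
  interchange = solve-∀

sumℤ-map-- : {A : Set} (g h : A → ℤ) (xs : List A) →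
             sumℤ (List.map (λ x → g x - h x) xs) ≡ sumℤ (List.map g xs) - sumℤ (List.map h xs)
sumℤ-map-- g h []       = refl
sumℤ-map-- g h (x ∷ xs) = trans (cong (_+_ (g x - h x)) (sumℤ-map-- g h xs)) (interchange (g x) (h x) _ _)
  where
  interchange : ∀ a b c d → (a - b) + (c - d) ≡ (a + c) - (b + d)
  interchange = solve-∀

module _ {m n : ℕ} where

  deg-split : (D : Divisor m n) → deg D ≡ (∑[ a < m ] D (inj₁ a)) + (∑[ b < n ] D (inj₂ b))
  deg-split D = begin
    sumℤ (List.map D (List.map inj₁ (allFin m) List.++ List.map inj₂ (allFin n)))
      ≡⟨ cong sumℤ (ListP.map-++ D (List.map inj₁ (allFin m)) _) ⟩
    sumℤ (List.map D (List.map inj₁ (allFin m)) List.++ List.map D (List.map inj₂ (allFin n)))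
      ≡⟨ sumℤ-++ (List.map D (List.map inj₁ (allFin m))) (List.map D (List.map inj₂ (allFin n))) ⟩
    sumℤ (List.map D (List.map inj₁ (allFin m))) + sumℤ (List.map D (List.map inj₂ (allFin n)))
      ≡⟨ cong₂ _+_ (sumℤ-map-map-tabulate D inj₁ id) (sumℤ-map-map-tabulate D inj₂ id) ⟩
    (∑[ a < m ] D (inj₁ a)) + (∑[ b < n ] D (inj₂ b)) ∎
    where open ≡-Reasoning

  Δ-inj₁ : (f : V m n → ℤ) (a : Fin m) → Δ f (inj₁ a) ≡ ∑[ b < n ] (f (inj₁ a) - f (inj₂ b))
  Δ-inj₁ f a = sumℤ-map-map-tabulate (λ R → f (inj₁ a) - f R) inj₂ id

  Δ-inj₂ : (f : V m n → ℤ) (b : Fin n) → Δ f (inj₂ b) ≡ ∑[ a < m ] (f (inj₂ b) - f (inj₁ a))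
  Δ-inj₂ f b = sumℤ-map-map-tabulate (λ R → f (inj₂ b) - f R) inj₁ id

  Δ-inj₁-expand : (f : V m n → ℤ) (a : Fin m) → Δ f (inj₁ a) ≡ + n * f (inj₁ a) - (∑[ b < n ] f (inj₂ b))
  Δ-inj₁-expand f a = trans (Δ-inj₁ f a) (trans (∑-distrib-- (λ _ → f (inj₁ a)) (f ∘ inj₂))
                                                (cong (_- _) (∑-const n (f (inj₁ a)))))

  Δ-inj₂-expand : (f : V m n → ℤ) (b : Fin n) → Δ f (inj₂ b) ≡ + m * f (inj₂ b) - (∑[ a < m ] f (inj₁ a))
  Δ-inj₂-expand f b = trans (Δ-inj₂ f b) (trans (∑-distrib-- (λ _ → f (inj₂ b)) (f ∘ inj₁))
                                                (cong (_- _) (∑-const m (f (inj₂ b)))))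

  deg-Δ : (f : V m n → ℤ) → deg (Δ f) ≡ + 0
  deg-Δ f = begin
    deg (Δ f)
      ≡⟨ deg-split (Δ f) ⟩
    (∑[ a < m ] Δ f (inj₁ a)) + (∑[ b < n ] Δ f (inj₂ b))
      ≡⟨ cong₂ _+_ (sum-cong-≗ (Δ-inj₁ f)) (trans (sum-cong-≗ (Δ-inj₂ f)) (∑-comm (λ b a → fb b - fa a))) ⟩
    (∑[ a < m ] ∑[ b < n ] (fa a - fb b)) + (∑[ a < m ] ∑[ b < n ] (fb b - fa a))
      ≡⟨ sym (∑-distrib-+ (λ a → ∑[ b < n ] (fa a - fb b)) (λ a → ∑[ b < n ] (fb b - fa a))) ⟩
    (∑[ a < m ] ((∑[ b < n ] (fa a - fb b)) + (∑[ b < n ] (fb b - fa a))))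
      ≡⟨ sum-cong-≗ (λ a → sym (∑-distrib-+ (λ b → fa a - fb b) (λ b → fb b - fa a))) ⟩
    (∑[ a < m ] ∑[ b < n ] ((fa a - fb b) + (fb b - fa a)))
      ≡⟨ sum-cong-≗ (λ a → trans (sum-cong-≗ (λ b → cancel (fa a) (fb b))) (sum-replicate-zero n)) ⟩
    (∑[ a < m ] (+ 0))
      ≡⟨ sum-replicate-zero m ⟩
    + 0 ∎
    where
    open ≡-Reasoning
    fa : Fin m → ℤ
    fa = f ∘ inj₁
    fb : Fin n → ℤ
    fb = f ∘ inj₂
    cancel : ∀ x y → (x - y) + (y - x) ≡ + 0
    cancel = solve-∀

  deg-cong : {D D' : Divisor m n} → (∀ Q → D Q ≡ D' Q) → deg D ≡ deg D'
  deg-cong D≗D' = cong sumℤ (ListP.map-cong D≗D' (vertices m n))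

  deg-+ : (D D' : Divisor m n) → deg (λ Q → D Q + D' Q) ≡ deg D + deg D'
  deg-+ D D' = sumℤ-map-+ D D' (vertices m n)

  deg-⊝ : (D D' : Divisor m n) → deg (D ⊝ D') ≡ deg D - deg D'
  deg-⊝ D D' = sumℤ-map-- D D' (vertices m n)

  Δ-linear : (f h : V m n → ℤ) (Q : V m n) → Δ (λ R → f R - h R) Q ≡ Δ f Q - Δ h Q
  Δ-linear f h Q = trans (cong sumℤ (ListP.map-cong (λ R → regroup (f Q) (h Q) (f R) (h R)) (neighbours Q)))
                         (sumℤ-map-- (λ R → f Q - f R) (λ R → h Q - h R) (neighbours Q))
    where
    regroup : ∀ a b c d → (a - b) - (c - d) ≡ (a - c) - (b - d)
    regroup = solve-∀

  Δ-zero : (Q : V m n) → Δ (λ _ → + 0) Q ≡ + 0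
  Δ-zero (inj₁ a) = trans (Δ-inj₁ (λ _ → + 0) a) (sum-replicate-zero n)
  Δ-zero (inj₂ b) = trans (Δ-inj₂ (λ _ → + 0) b) (sum-replicate-zero m)

  deg-nonneg : {E : Divisor m n} → Effective E → + 0 ≤ deg E
  deg-nonneg {E} E≥0 = ℤP.≤-trans (ℤP.+-mono-≤ (∑-nonneg (E≥0 ∘ inj₁)) (∑-nonneg (E≥0 ∘ inj₂)))
                                  (ℤP.≤-reflexive (sym (deg-split E)))

  firing⇒LinSysNonempty : {D : Divisor m n} (f : V m n → ℤ) → Effective (λ Q → D Q + Δ f Q) → LinSysNonempty D
  firing⇒LinSysNonempty {D} f D+Δf≥0 = _ , D+Δf≥0 , f , λ Q → cancel (D Q) (Δ f Q)
    where
    cancel : ∀ x y → (x + y) - x ≡ y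
    cancel = solve-∀

  LinSysNonempty⇒firing : {D : Divisor m n} → LinSysNonempty D → ∃ λ f → Effective (λ Q → D Q + Δ f Q)
  LinSysNonempty⇒firing {D} (E , E≥0 , f , E-D≡Δf) = f , λ Q → subst (+ 0 ≤_) (shift (E Q) (D Q) (E-D≡Δf Q)) (E≥0 Q)
    where
    shift : ∀ x y {z} → x - y ≡ z → x ≡ y + z
    shift x y refl = sym (cancel x y)
      where
      cancel : ∀ x y → y + (x - y) ≡ x
      cancel = solve-∀

  Effective⇒LinSysNonempty : {D : Divisor m n} → Effective D → LinSysNonempty D
  Effective⇒LinSysNonempty {D} D≥0 = D , D≥0 , (λ _ → + 0) , λ Q → trans (ℤP.+-inverseʳ (D Q)) (sym (Δ-zero Q))

  LinSysNonempty-linEquiv : {D D' : Divisor m n} (h : V m n → ℤ) → (∀ Q → D' Q ≡ D Q + Δ h Q) →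
                            LinSysNonempty D → LinSysNonempty D'
  LinSysNonempty-linEquiv {D} {D'} h D'≡D+Δh |D|≠∅ with LinSysNonempty⇒firing |D|≠∅
  ... | f , D+Δf≥0 = firing⇒LinSysNonempty (λ R → f R - h R) λ Q → subst (+ 0 ≤_) (same Q) (D+Δf≥0 Q)
    where
    same : ∀ Q → D Q + Δ f Q ≡ D' Q + Δ (λ R → f R - h R) Q
    same Q = begin
      D Q + Δ f Q                           ≡⟨ regroup (D Q) (Δ f Q) (Δ h Q) ⟩
      (D Q + Δ h Q) + (Δ f Q - Δ h Q)       ≡⟨ cong₂ _+_ (sym (D'≡D+Δh Q)) (sym (Δ-linear f h Q)) ⟩
      D' Q + Δ (λ R → f R - h R) Q          ∎
      where
      open ≡-Reasoning
      regroup : ∀ d x y → d + x ≡ (d + y) + (x - y)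
      regroup = solve-∀

  LinSysNonempty⇒deg-nonneg : {D : Divisor m n} → LinSysNonempty D → + 0 ≤ deg D
  LinSysNonempty⇒deg-nonneg {D} (E , E≥0 , f , E-D≡Δf) = ℤP.≤-trans (deg-nonneg E≥0) (ℤP.≤-reflexive degE≡degD)
    where
    degE≡degD : deg E ≡ deg D
    degE≡degD = ℤP.i-j≡0⇒i≡j (deg E) (deg D) (trans (sym (deg-⊝ E D)) (trans (deg-cong E-D≡Δf) (deg-Δ f)))

  LinSysNonempty-addEffective : {D X : Divisor m n} → Effective X → LinSysNonempty (D ⊝ X) → LinSysNonempty D
  LinSysNonempty-addEffective {D} {X} X≥0 (E , E≥0 , f , eq) =
    (λ Q → E Q + X Q) , (λ Q → ℤP.+-mono-≤ (E≥0 Q) (X≥0 Q)) , f , λ Q → trans (regroup (E Q) (X Q) (D Q)) (eq Q)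
    where
    regroup : ∀ e x d → (e + x) - d ≡ e - (d - x)
    regroup = solve-∀

  ·-self : (c : ℤ) (P : V m n) → (c · P) P ≡ c
  ·-self c P with ≡-dec Fin._≟_ Fin._≟_ P P
  ... | yes _   = refl
  ... | no  P≢P = contradiction refl P≢P

  ·-other : (c : ℤ) {P Q : V m n} → P ≢ Q → (c · P) Q ≡ + 0
  ·-other c {P} {Q} P≢Q with ≡-dec Fin._≟_ Fin._≟_ P Q
  ... | yes P≡Q = contradiction P≡Q P≢Q
  ... | no  _   = refl

  ·-effective : {c : ℤ} → + 0 ≤ c → (P : V m n) → Effective (c · P)
  ·-effective {c} 0≤c P Q with ≡-dec Fin._≟_ Fin._≟_ P Q
  ... | yes _ = 0≤c
  ... | no  _ = ℤP.≤-refl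

  ∑-·-inj₁ : (c : ℤ) (i : Fin m) → ∑[ a < m ] (c · inj₁ i) (inj₁ a) ≡ c
  ∑-·-inj₁ c i = trans (∑-single _ i (λ a i≢a → ·-other c {inj₁ i} (i≢a ∘ inj₁-injective))) (·-self c (inj₁ i))

  deg-· : (c : ℤ) (P : V m n) → deg (c · P) ≡ c
  deg-· c P@(inj₁ i) = begin
    deg (c · P)                                                 ≡⟨ deg-split (c · P) ⟩
    (∑[ a < m ] (c · P) (inj₁ a)) + (∑[ b < n ] (c · P) (inj₂ b))
      ≡⟨ cong₂ _+_ (∑-single _ i (λ a i≢a → ·-other c {P} (i≢a ∘ inj₁-injective)))
                   (trans (sum-cong-≗ (λ b → ·-other c {P} {inj₂ b} λ ())) (sum-replicate-zero n)) ⟩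
    (c · P) (inj₁ i) + + 0                                      ≡⟨ ℤP.+-identityʳ _ ⟩
    (c · P) (inj₁ i)                                            ≡⟨ ·-self c P ⟩
    c                                                                ∎
    where open ≡-Reasoning
  deg-· c P@(inj₂ j) = begin
    deg (c · P)                                                 ≡⟨ deg-split (c · P) ⟩
    (∑[ a < m ] (c · P) (inj₁ a)) + (∑[ b < n ] (c · P) (inj₂ b))
      ≡⟨ cong₂ _+_ (trans (sum-cong-≗ (λ a → ·-other c {P} {inj₁ a} λ ())) (sum-replicate-zero m))
                   (∑-single _ j (λ b j≢b → ·-other c {P} (j≢b ∘ inj₂-injective))) ⟩
    + 0 + (c · P) (inj₂ j)                                      ≡⟨ ℤP.+-identityˡ _ ⟩
    (c · P) (inj₂ j)                                            ≡⟨ ·-self c P ⟩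
    c                                                                ∎
    where open ≡-Reasoning

  LinSysNonempty-resp : {D D' : Divisor m n} → (∀ Q → D Q ≡ D' Q) → LinSysNonempty D → LinSysNonempty D'
  LinSysNonempty-resp D≗D' (E , E≥0 , f , eq) = E , E≥0 , f , λ Q → trans (cong (_-_ (E Q)) (sym (D≗D' Q))) (eq Q)

  RankCond-antitone : (v : V m n) {D : Divisor m n} {j j' : ℕ} → j' ℕ.≤ j → RankCond D j → RankCond D j'
  RankCond-antitone v {D} {j} {j'} j'≤j rank≥j E E≥0 degE≡j' =
    LinSysNonempty-addEffective X≥0 (LinSysNonempty-resp regroup (rank≥j (λ Q → E Q + X Q) E+X≥0 degE+X≡j))
    where
    X : Divisor m n
    X = (+ (j ℕ.∸ j')) · v
    X≥0 : Effective X
    X≥0 = ·-effective (+≤+ z≤n) v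
    E+X≥0 : Effective (λ Q → E Q + X Q)
    E+X≥0 Q = ℤP.+-mono-≤ (E≥0 Q) (X≥0 Q)
    degE+X≡j : deg (λ Q → E Q + X Q) ≡ + j
    degE+X≡j = begin
      deg (λ Q → E Q + X Q)  ≡⟨ deg-+ E X ⟩
      deg E + deg X          ≡⟨ cong₂ _+_ degE≡j' (deg-· _ v) ⟩
      + j' + + (j ℕ.∸ j')    ≡⟨ ℤP.pos-+ j' (j ℕ.∸ j') ⟨
      + (j' ℕ.+ (j ℕ.∸ j'))  ≡⟨ cong +_ (ℕP.m+[n∸m]≡n j'≤j) ⟩
      + j                    ∎
      where open ≡-Reasoning
    regroup : ∀ Q → D Q - (E Q + X Q) ≡ (D Q - E Q) - X Q
    regroup Q = sub-+ (D Q) (E Q) (X Q)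
      where
      sub-+ : ∀ d e x → d - (e + x) ≡ (d - e) - x
      sub-+ = solve-∀

  RankCond⇒≤deg : (v : V m n) {D : Divisor m n} {k : ℕ} → RankCond D k → + k ≤ deg D
  RankCond⇒≤deg v {D} {k} rank≥k = ℤP.0≤i-j⇒j≤i (subst (+ 0 ≤_) degD-k
    (LinSysNonempty⇒deg-nonneg (rank≥k ((+ k) · v) (·-effective (+≤+ z≤n) v) (deg-· (+ k) v))))
    where
    degD-k : deg (D ⊝ ((+ k) · v)) ≡ deg D - + k
    degD-k = trans (deg-⊝ D ((+ k) · v)) (cong (_-_ (deg D)) (deg-· (+ k) v))

  IsRank-intro : (v : V m n) {D : Divisor m n} (r : ℕ) →
                 LinSysNonempty D → RankCond D r → ¬ RankCond D (suc r) → IsRank D (+ r)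
  IsRank-intro v {D} r |D|≠∅ rank≥r rank≱r+1 =
    |D|≠∅ , rank≥r , λ j r<j rank≥j → rank≱r+1 (RankCond-antitone v {D} r<j rank≥j)

  IsRank-unique : {D : Divisor m n} {r r' : ℤ} → IsRank D r → IsRank D r' → r ≡ r'
  IsRank-unique {r = -[1+ zero ]} { -[1+ zero ]} _ _ = refl
  IsRank-unique {r = -[1+ zero ]} {+ _} |D|=∅ (|D|≠∅ , _) = contradiction |D|≠∅ |D|=∅
  IsRank-unique {r = + _} { -[1+ zero ]} (|D|≠∅ , _) |D|=∅ = contradiction |D|≠∅ |D|=∅
  IsRank-unique {r = + k} {+ k'} (_ , rank≥k , maxk) (_ , rank≥k' , maxk') with ℕP.<-cmp k k'
  ... | tri< k<k' _ _ = contradiction rank≥k' (maxk k' k<k')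
  ... | tri≈ _ k≡k' _ = cong +_ k≡k'
  ... | tri> _ _ k'<k = contradiction rank≥k (maxk' k k'<k)

  IsRank-negative : {D : Divisor m n} → deg D < + 0 → IsRank D -[1+ 0 ]
  IsRank-negative deg<0 |D|≠∅ = ℤP.<⇒≱ deg<0 (LinSysNonempty⇒deg-nonneg |D|≠∅)

𝟙-compensates-≤ : ∀ {A : Set} (d : Dec A) {x y z k} → x ≤ + y → (A → y ℕ.≤ z) → y ℕ.< k →
                  + 0 ≤ + z + + k * (+ 1 - 𝟙 d) - x
𝟙-compensates-≤ (yes a) {x} {y} {z} {k} x≤y y≤z _ =
  ℤP.i≤j⇒0≤j-i (ℤP.≤-trans x≤y (ℤP.≤-trans (+≤+ (y≤z a)) (ℤP.≤-reflexive (sym (drop (+ z) (+ k))))))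
  where
  drop : ∀ u v → u + v * (+ 1 - + 1) ≡ u
  drop = solve-∀
𝟙-compensates-≤ (no _) {x} {y} {z} {k} x≤y _ y<k =
  ℤP.i≤j⇒0≤j-i (ℤP.≤-trans x≤y (ℤP.≤-trans (+≤+ (ℕP.≤-trans (ℕP.<⇒≤ y<k) (ℕP.m≤n+m k z)))
                                           (ℤP.≤-reflexive (sym (keep (+ z) (+ k))))))
  where
  keep : ∀ u v → u + v * (+ 1 - + 0) ≡ u + v
  keep = solve-∀

𝟙-compensates-< : ∀ x {z k} → z ℕ.< k → + 0 ≤ + x - + z + + k * 𝟙 (x ℕ.<? z)
𝟙-compensates-< x {z} {k} z<k with x ℕ.<? z
... | yes _   = subst (+ 0 ≤_) (regroup (+ x) (+ z) (+ k))
                      (ℤP.+-mono-≤ (+≤+ z≤n) (ℤP.i≤j⇒0≤j-i (+≤+ (ℕP.<⇒≤ z<k))))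
  where
  regroup : ∀ u v w → u + (w - v) ≡ u - v + w * + 1
  regroup = solve-∀
... | no  x≮z = subst (+ 0 ≤_) (sym (drop (+ x - + z) (+ k))) (ℤP.i≤j⇒0≤j-i (+≤+ (ℕP.≮⇒≥ x≮z)))
  where
  drop : ∀ u w → u + w * + 0 ≡ u
  drop = solve-∀

-- Test divisors for the upper bound, in coordinates in which P sits at 0: E is eP plus the
-- points 1, …, q + 1, the firing h is −q at P and 1 at 2, …, q + 1, and testResult is the value
-- of kP − E + Δh on the m-side (it vanishes on the n-side).
pointAt0 : ℤ → ℕ → ℤ
pointAt0 c zero    = c
pointAt0 c (suc _) = + 0

testDivisor : ℕ → ℕ → ℕ → ℤ
testDivisor e q zero    = + e
testDivisor e q (suc x) = 𝟙 (x ℕ.<? suc q)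

testFiring : ℕ → ℕ → ℤ
testFiring q zero          = - + q
testFiring q (suc zero)    = + 0
testFiring q (suc (suc x)) = 𝟙 (x ℕ.<? q)

testDivisor-nonneg : ∀ e q x → + 0 ≤ testDivisor e q x
testDivisor-nonneg e q zero    = +≤+ z≤n
testDivisor-nonneg e q (suc x) = 𝟙-nonneg (x ℕ.<? suc q)

∑-testDivisor : ∀ {k} e q → q ℕ.< k → ∑[ t < suc k ] testDivisor e q (toℕ t) ≡ + e + + suc q
∑-testDivisor e q q<k = cong (_+_ (+ e)) (count-< (suc q) q<k)

∑-testFiring : ∀ {k} q → q ℕ.< k → ∑[ t < suc k ] testFiring q (toℕ t) ≡ + 0
∑-testFiring {suc k} q (s≤s q≤k) = begin
  - + q + (+ 0 + (∑[ t < k ] 𝟙 (toℕ t ℕ.<? q)))  ≡⟨ cong (λ c → - + q + (+ 0 + c)) (count-< q q≤k) ⟩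
  - + q + (+ 0 + + q)                           ≡⟨ cancel (+ q) ⟩
  + 0                                           ∎
  where
  open ≡-Reasoning
  cancel : ∀ x → - x + (+ 0 + x) ≡ + 0
  cancel = solve-∀

testResult : ℕ → ℕ → ℕ → ℕ → ℕ → ℤ
testResult n k e q x = (pointAt0 (+ k) x - testDivisor e q x) + (+ n * testFiring q x - + 0)

testResult-1 : ∀ n' k e q → testResult (suc n') k e q 1 ≡ -[1+ 0 ]
testResult-1 n' k e q = regroup (+ n')
  where
  regroup : ∀ n' → (+ 0 - + 1) + ((+ 1 + n') * + 0 - + 0) ≡ -[1+ 0 ]
  regroup = solve-∀

testResult<n : ∀ n' k e q → k ℕ.≤ e ℕ.+ suc n' ℕ.* q ℕ.+ n' → ∀ x → testResult (suc n') k e q x < + suc n'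
testResult<n n' k e q k≤ zero = begin-strict
  (+ k - + e) + (+ suc n' * - + q - + 0)   ≡⟨ regroup (+ k) (+ e) (+ n') (+ q) ⟩
  + k - (+ e + + suc n' * + q)             ≤⟨ ℤP.+-monoˡ-≤ (- (+ e + + suc n' * + q)) (+≤+ k≤) ⟩
  + (e ℕ.+ suc n' ℕ.* q ℕ.+ n') - (+ e + + suc n' * + q)
                                           ≡⟨ cong (_- (+ e + + suc n' * + q)) (trans (ℤP.pos-+ (e ℕ.+ suc n' ℕ.* q) n')
                                                (cong (_+ + n') (trans (ℤP.pos-+ e (suc n' ℕ.* q)) (cong (_+_ (+ e)) (ℤP.pos-* (suc n') q))))) ⟩
  (+ e + + suc n' * + q + + n') - (+ e + + suc n' * + q)
                                           ≡⟨ cancel (+ e + + suc n' * + q) (+ n') ⟩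
  + n'                                     <⟨ +<+ (ℕP.n<1+n n') ⟩
  + suc n'                                 ∎
  where
  open ℤP.≤-Reasoning
  regroup : ∀ k e n' q → (k - e) + ((+ 1 + n') * - q - + 0) ≡ k - (e + (+ 1 + n') * q)
  regroup = solve-∀
  cancel : ∀ x y → x + y - x ≡ y
  cancel = solve-∀
testResult<n n' k e q k≤ (suc zero) = ℤP.≤-<-trans (ℤP.≤-reflexive (testResult-1 n' k e q)) ℤ.-<+
testResult<n n' k e q k≤ (suc (suc x)) =
  ℤP.≤-<-trans (ℤP.≤-reflexive (trans (cong (λ c → (+ 0 - c) + (+ suc n' * ι - + 0)) same) (regroup (+ n') ι)))
               (ℤP.≤-<-trans n'ι≤n' (+<+ (ℕP.n<1+n n')))
  where
  same : 𝟙 (suc x ℕ.<? suc q) ≡ 𝟙 (x ℕ.<? q)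
  same = 𝟙-cong (suc x ℕ.<? suc q) (x ℕ.<? q) ℕ.s<s⁻¹ ℕ.s<s
  ι : ℤ
  ι = 𝟙 (x ℕ.<? q)
  regroup : ∀ n' ι → (+ 0 - ι) + ((+ 1 + n') * ι - + 0) ≡ n' * ι
  regroup = solve-∀
  n'ι≤n' : + n' * ι ≤ + n'
  n'ι≤n' = ℤP.≤-trans (ℤP.*-monoˡ-≤-nonNeg (+ n') (𝟙-≤1 (x ℕ.<? q))) (ℤP.≤-reflexive (ℤP.*-identityʳ (+ n')))

genus-shift : ∀ m' n' j → m' ℕ.+ j ℕ.+ m' ℕ.* n' ≡ m' ℕ.* suc n' ℕ.+ j
genus-shift = ℕSolver.solve-∀

degree-shift : ∀ p n' j → suc p ℕ.* suc n' ℕ.+ j ≡ suc j ℕ.+ suc n' ℕ.* p ℕ.+ n'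
degree-shift = ℕSolver.solve-∀

module _ {m' n' : ℕ} where

  private
    m n : ℕ
    m = suc m'
    n = suc n'

  -- If f a₀ is at most min f on the n-side, then Δf(a₀) ≤ 0.  Otherwise, if the minimum on the
  -- n-side is also at most min f on the m-side, that vertex loses at least 1 towards a₀; else the
  -- minimum on the m-side loses at least 1 towards each of the n vertices of the other side.
  firing-somewhere-negative : (D : Divisor m n) (a₀ : Fin m) → D (inj₁ a₀) < + 0 → (∀ b → D (inj₂ b) ≤ + 0) →
                              (∀ a → D (inj₁ a) < + n) → (f : V m n → ℤ) → ∃ λ Q → D Q + Δ f Q < + 0
  firing-somewhere-negative D a₀ Da₀<0 DB≤0 DA<n f
    with argmin (f ∘ inj₁) | argmin (f ∘ inj₂)
  ... | aμ , aμ-min | bμ , bμ-min with f (inj₁ a₀) ℤP.≤? f (inj₂ bμ) | f (inj₂ bμ) ℤP.≤? f (inj₁ aμ)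
  ...   | yes fa₀≤fbμ | _ = inj₁ a₀ , ℤP.+-mono-<-≤ Da₀<0 Δ≤0
    where
    Δ≤0 : Δ f (inj₁ a₀) ≤ + 0
    Δ≤0 = subst (_≤ + 0) (sym (Δ-inj₁ f a₀))
            (∑-nonpos λ b → ℤP.i≤j⇒i-j≤0 (ℤP.≤-trans fa₀≤fbμ (bμ-min b)))
  ...   | no fa₀≰fbμ | yes fbμ≤faμ = inj₂ bμ , ℤP.+-mono-≤-< (DB≤0 bμ) Δ<0
    where
    Δ<0 : Δ f (inj₂ bμ) < + 0
    Δ<0 = ℤP.≤-<-trans (subst (_≤ -[1+ 0 ]) (sym (Δ-inj₂ f bμ))
            (ℤP.≤-trans (∑-nonpos-≤-term (λ a → ℤP.i≤j⇒i-j≤0 (ℤP.≤-trans fbμ≤faμ (aμ-min a))) a₀)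
                        (i<j⇒i-j≤-1 (ℤP.≰⇒> fa₀≰fbμ))))
            ℤ.-<+
  ...   | no _ | no fbμ≰faμ = inj₁ aμ , ℤP.<-≤-trans (ℤP.+-mono-<-≤ (DA<n aμ) Δ≤-n) (ℤP.≤-reflexive (cancel (+ n)))
    where
    Δ≤-n : Δ f (inj₁ aμ) ≤ + n * -[1+ 0 ]
    Δ≤-n = subst (_≤ + n * -[1+ 0 ]) (sym (Δ-inj₁ f aμ))
             (∑-≤-const -[1+ 0 ] λ b → i<j⇒i-j≤-1 (ℤP.<-≤-trans (ℤP.≰⇒> fbμ≰faμ) (bμ-min b)))
    cancel : ∀ x → x + x * -[1+ 0 ] ≡ + 0
    cancel = solve-∀

  LinSysEmpty-criterion : (D : Divisor m n) (a₀ : Fin m) → D (inj₁ a₀) < + 0 → (∀ b → D (inj₂ b) ≤ + 0) →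
                          (∀ a → D (inj₁ a) < + n) → ¬ LinSysNonempty D
  LinSysEmpty-criterion D a₀ Da₀<0 DB≤0 DA<n |D|≠∅ = ℤP.<⇒≱ D+Δf<0 (D+Δf≥0 Q)
    where
    f : V m n → ℤ
    f = proj₁ (LinSysNonempty⇒firing |D|≠∅)
    D+Δf≥0 : Effective (λ Q → D Q + Δ f Q)
    D+Δf≥0 = proj₂ (LinSysNonempty⇒firing |D|≠∅)
    Q : V m n
    Q = proj₁ (firing-somewhere-negative D a₀ Da₀<0 DB≤0 DA<n f)
    D+Δf<0 : D Q + Δ f Q < + 0
    D+Δf<0 = proj₂ (firing-somewhere-negative D a₀ Da₀<0 DB≤0 DA<n f)

  -- Write D(a) = r a + n q a with 0 ≤ r a < n and order the m-side by (r a, a).  For every a' the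
  -- function firing a' turns D into a divisor that is nonnegative as soon as F a' ≤ r a', and
  -- the sum of F a' − r a' over all a' is n(m − 1) − deg D < m, so some a' qualifies.
  module NonSpecial (D : Divisor m n) where

    r : Fin m → ℕ
    r a = D (inj₁ a) %ℕ n

    q : Fin m → ℤ
    q a = D (inj₁ a) /ℕ n

    residue : Fin m → Fin n
    residue a = Fin.fromℕ< (n%ℕd<d (D (inj₁ a)) n)

    toℕ-residue : ∀ a → toℕ (residue a) ≡ r a
    toℕ-residue a = FinP.toℕ-fromℕ< (n%ℕd<d (D (inj₁ a)) n)

    key : Fin m → Fin (n ℕ.* m)
    key a = Fin.combine (residue a) a

    key-injective : Injective _≡_ _≡_ key
    key-injective {a} {a'} eq = proj₂ (FinP.combine-injective (residue a) a (residue a') a' eq)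

    key-≤⇒r-≤ : ∀ {a a'} → key a' Fin.≤ key a → r a' ℕ.≤ r a
    key-≤⇒r-≤ {a} {a'} ka'≤ka = ℕP.≮⇒≥ λ ra<ra' →
      ℕP.<⇒≱ (FinP.combine-monoˡ-< a a' (subst₂ ℕ._<_ (sym (toℕ-residue a)) (sym (toℕ-residue a')) ra<ra')) ka'≤ka

    open Ranking key key-injective

    Q : ℤ
    Q = ∑[ a < m ] q a

    y : Fin n → ℤ
    y b = + m' - Q - D (inj₂ b)

    s : Fin n → ℕ
    s b = y b %ℕ m

    w : Fin n → ℤ
    w b = y b /ℕ m

    firing : Fin m → V m n → ℤ
    firing a' (inj₁ a) = + 1 - q a - 𝟙 (key a' FinP.≤? key a)
    firing a' (inj₂ b) = w b + 𝟙 (toℕ (position a') ℕ.<? s b)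

    F : Fin m → ℤ
    F a' = ∑[ b < n ] firing a' (inj₂ b)

    ∑-firing-inj₁ : ∀ a' → ∑[ a < m ] firing a' (inj₁ a) ≡ + m * + 1 - Q - (+ 1 + #larger a')
    ∑-firing-inj₁ a' = begin
      ∑[ a < m ] (+ 1 - q a - 𝟙 (key a' FinP.≤? key a))
        ≡⟨ ∑-distrib-- (λ a → + 1 - q a) (λ a → 𝟙 (key a' FinP.≤? key a)) ⟩
      (∑[ a < m ] (+ 1 - q a)) - (∑[ a < m ] 𝟙 (key a' FinP.≤? key a))
        ≡⟨ cong₂ _-_ (trans (∑-distrib-- (λ _ → + 1) q) (cong (_- Q) (∑-const m (+ 1)))) (∑-atLeast a') ⟩
      + m * + 1 - Q - (+ 1 + #larger a')
        ∎
      where open ≡-Reasoning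

    fired-inj₁ : ∀ a' a → D (inj₁ a) + Δ (firing a') (inj₁ a) ≡ + r a + + n * (+ 1 - 𝟙 (key a' FinP.≤? key a)) - F a'
    fired-inj₁ a' a = begin
      D (inj₁ a) + Δ (firing a') (inj₁ a)
        ≡⟨ cong₂ _+_ (a≡a%ℕn+[a/ℕn]*n (D (inj₁ a)) n) (Δ-inj₁-expand (firing a') a) ⟩
      (+ r a + q a * + n) + (+ n * (+ 1 - q a - ι) - F a')
        ≡⟨ cancel (+ r a) (q a) (+ n) ι (F a') ⟩
      + r a + + n * (+ 1 - ι) - F a'
        ∎
      where
      open ≡-Reasoning
      ι : ℤ
      ι = 𝟙 (key a' FinP.≤? key a)
      cancel : ∀ r q n ι F → (r + q * n) + (n * (+ 1 - q - ι) - F) ≡ r + n * (+ 1 - ι) - F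
      cancel = solve-∀

    fired-inj₂ : ∀ a' b → D (inj₂ b) + Δ (firing a') (inj₂ b)
                        ≡ + toℕ (position a') - + s b + + m * 𝟙 (toℕ (position a') ℕ.<? s b)
    fired-inj₂ a' b = begin
      D (inj₂ b) + Δ (firing a') (inj₂ b)
        ≡⟨ cong₂ _+_ (solve-D (D (inj₂ b)) (+ m') Q) (Δ-inj₂-expand (firing a') b) ⟩
      (+ m' - Q - y b) + (+ m * (w b + ι) - ∑[ a < m ] firing a' (inj₁ a))
        ≡⟨ cong₂ (λ yb ∑f → (+ m' - Q - yb) + (+ m * (w b + ι) - ∑f))
                 (a≡a%ℕn+[a/ℕn]*n (y b) m) (∑-firing-inj₁ a') ⟩
      (+ m' - Q - (+ s b + w b * + m)) + (+ m * (w b + ι) - (+ m * + 1 - Q - (+ 1 + #larger a')))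
        ≡⟨ cancel (+ m') Q (+ s b) (w b) ι (#larger a') ⟩
      #larger a' - + s b + + m * ι
        ≡⟨ cong (λ A → A - + s b + + m * ι) (sym (toℕ-position a')) ⟩
      + toℕ (position a') - + s b + + m * ι
        ∎
      where
      open ≡-Reasoning
      ι : ℤ
      ι = 𝟙 (toℕ (position a') ℕ.<? s b)
      solve-D : ∀ d m' Q → d ≡ m' - Q - (m' - Q - d)
      solve-D = solve-∀
      cancel : ∀ m' Q s w ι A → (m' - Q - (s + w * (+ 1 + m'))) + ((+ 1 + m') * (w + ι) - ((+ 1 + m') * + 1 - Q - (+ 1 + A)))
                                ≡ A - s + (+ 1 + m') * ι
      cancel = solve-∀

    firing-effective : ∀ a' → F a' ≤ + r a' → Effective (λ Q → D Q + Δ (firing a') Q)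
    firing-effective a' F≤r (inj₁ a) =
      subst (+ 0 ≤_) (sym (fired-inj₁ a' a))
            (𝟙-compensates-≤ (key a' FinP.≤? key a) F≤r key-≤⇒r-≤ (n%ℕd<d (D (inj₁ a')) n))
    firing-effective a' F≤r (inj₂ b) =
      subst (+ 0 ≤_) (sym (fired-inj₂ a' b)) (𝟙-compensates-< (toℕ (position a')) (n%ℕd<d (y b) m))

    ∑-firing-column : ∀ b → ∑[ a' < m ] firing a' (inj₂ b) ≡ y b
    ∑-firing-column b = begin
      ∑[ a' < m ] (w b + 𝟙 (toℕ (position a') ℕ.<? s b))
        ≡⟨ ∑-distrib-+ (λ _ → w b) (λ a' → 𝟙 (toℕ (position a') ℕ.<? s b)) ⟩
      (∑[ _ < m ] w b) + (∑[ a' < m ] 𝟙 (toℕ (position a') ℕ.<? s b))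
        ≡⟨ cong₂ _+_ (∑-const m (w b)) (count-position< (s b) (ℕP.<⇒≤ (n%ℕd<d (y b) m))) ⟩
      + m * w b + + s b
        ≡⟨ trans (ℤP.+-comm (+ m * w b) (+ s b)) (cong (_+_ (+ s b)) (ℤP.*-comm (+ m) (w b))) ⟩
      + s b + w b * + m
        ≡⟨ a≡a%ℕn+[a/ℕn]*n (y b) m ⟨
      y b
        ∎
      where open ≡-Reasoning

    ∑-r : ∑[ a < m ] (+ r a) ≡ (∑[ a < m ] D (inj₁ a)) - Q * + n
    ∑-r = begin
      ∑[ a < m ] (+ r a)
        ≡⟨ cancel (∑[ a < m ] (+ r a)) (Q * + n) ⟨
      (∑[ a < m ] (+ r a)) + Q * + n - Q * + n
        ≡⟨ cong (λ x → (∑[ a < m ] (+ r a)) + x - Q * + n) (*-distribʳ-sum (+ n) q) ⟩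
      (∑[ a < m ] (+ r a)) + (∑[ a < m ] (q a * + n)) - Q * + n
        ≡⟨ cong (_- Q * + n) (∑-distrib-+ (λ a → + r a) (λ a → q a * + n)) ⟨
      (∑[ a < m ] (+ r a + q a * + n)) - Q * + n
        ≡⟨ cong (_- Q * + n) (sum-cong-≗ {m} λ a → a≡a%ℕn+[a/ℕn]*n (D (inj₁ a)) n) ⟨
      (∑[ a < m ] D (inj₁ a)) - Q * + n
        ∎
      where
      open ≡-Reasoning
      cancel : ∀ x y → x + y - y ≡ x
      cancel = solve-∀

    ∑-excess : ∑[ a' < m ] (F a' - + r a') ≡ + n * + m' - deg D
    ∑-excess = begin
      ∑[ a' < m ] (F a' - + r a')
        ≡⟨ ∑-distrib-- F (λ a' → + r a') ⟩
      (∑[ a' < m ] ∑[ b < n ] firing a' (inj₂ b)) - (∑[ a < m ] (+ r a))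
        ≡⟨ cong₂ _-_ (trans (∑-comm (λ a' b → firing a' (inj₂ b))) (sum-cong-≗ {n} ∑-firing-column)) ∑-r ⟩
      (∑[ b < n ] (+ m' - Q - D (inj₂ b))) - ((∑[ a < m ] D (inj₁ a)) - Q * + n)
        ≡⟨ cong (_- ((∑[ a < m ] D (inj₁ a)) - Q * + n))
                (trans (∑-distrib-- (λ _ → + m' - Q) (λ b → D (inj₂ b)))
                       (cong (_- (∑[ b < n ] D (inj₂ b))) (∑-const n (+ m' - Q)))) ⟩
      (+ n * (+ m' - Q) - (∑[ b < n ] D (inj₂ b))) - ((∑[ a < m ] D (inj₁ a)) - Q * + n)
        ≡⟨ regroup (+ n) (+ m') Q (∑[ a < m ] D (inj₁ a)) (∑[ b < n ] D (inj₂ b)) ⟩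
      + n * + m' - ((∑[ a < m ] D (inj₁ a)) + (∑[ b < n ] D (inj₂ b)))
        ≡⟨ cong (_-_ (+ n * + m')) (deg-split D) ⟨
      + n * + m' - deg D
        ∎
      where
      open ≡-Reasoning
      regroup : ∀ n m' Q A B → (n * (m' - Q) - B) - (A - Q * n) ≡ n * m' - (A + B)
      regroup = solve-∀

    excess≤m' : + (m' ℕ.* n') ≤ deg D → ∑[ a' < m ] (F a' - + r a') ≤ + m'
    excess≤m' g≤deg = begin
      ∑[ a' < m ] (F a' - + r a')  ≡⟨ ∑-excess ⟩
      + n * + m' - deg D           ≤⟨ ℤP.+-monoʳ-≤ (+ n * + m') (ℤP.neg-mono-≤ g≤deg) ⟩
      + n * + m' - + (m' ℕ.* n')   ≡⟨ cong (λ g → + n * + m' - g) (ℤP.pos-* m' n') ⟩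
      + n * + m' - + m' * + n'     ≡⟨ cancel (+ m') (+ n') ⟩
      + m'                         ∎
      where
      open ℤP.≤-Reasoning
      cancel : ∀ m' n' → (+ 1 + n') * m' - m' * n' ≡ m'
      cancel = solve-∀

    nonempty : + (m' ℕ.* n') ≤ deg D → LinSysNonempty D
    nonempty g≤deg = firing⇒LinSysNonempty (firing a') (firing-effective a' (ℤP.i-j≤0⇒i≤j F-r≤0))
      where
      excess<m : ∑[ a' < m ] (F a' - + r a') < + m
      excess<m = ℤP.≤-<-trans (excess≤m' g≤deg) (+<+ (ℕP.n<1+n m'))
      a' : Fin m
      a' = proj₁ (∑<k⇒∃≤0 (λ a' → F a' - + r a') excess<m)
      F-r≤0 : F a' - + r a' ≤ + 0
      F-r≤0 = proj₂ (∑<k⇒∃≤0 (λ a' → F a' - + r a') excess<m)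

  LinSysNonempty-of-genus≤deg : (D : Divisor m n) → + (m' ℕ.* n') ≤ deg D → LinSysNonempty D
  LinSysNonempty-of-genus≤deg D = NonSpecial.nonempty D

  RankCond-of-genus : {D : Divisor m n} (r : ℕ) → + (r ℕ.+ m' ℕ.* n') ≤ deg D → RankCond D r
  RankCond-of-genus {D} r r+g≤deg E E≥0 degE≡r = LinSysNonempty-of-genus≤deg (D ⊝ E) g≤deg
    where
    g≤deg : + (m' ℕ.* n') ≤ deg (D ⊝ E)
    g≤deg = begin
      + (m' ℕ.* n')                  ≡⟨ cancel (+ r) (+ (m' ℕ.* n')) ⟨
      + r + + (m' ℕ.* n') - + r      ≤⟨ ℤP.+-monoˡ-≤ (- + r) r+g≤deg ⟩
      deg D - + r                    ≡⟨ cong (_-_ (deg D)) degE≡r ⟨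
      deg D - deg E                  ≡⟨ deg-⊝ D E ⟨
      deg (D ⊝ E)                    ∎
      where
      open ℤP.≤-Reasoning
      cancel : ∀ x y → x + y - x ≡ y
      cancel = solve-∀

  module _ (i : Fin m) where

    private
      P : V m n
      P = inj₁ i

    n*qP≤kP : ∀ {k q} → n ℕ.* q ℕ.≤ k → ∀ a → + n * ((+ q) · P) (inj₁ a) ≤ ((+ k) · P) (inj₁ a)
    n*qP≤kP {k} {q} nq≤k a with i Fin.≟ a
    ... | yes refl = subst (_≤ + k) (ℤP.pos-* n q) (+≤+ nq≤k)
    ... | no  _    = ℤP.≤-reflexive (ℤP.*-zeroʳ (+ n))

    module LowerBound {k q : ℕ} (nq≤k : n ℕ.* q ℕ.≤ k) (E : Divisor m n) (E≥0 : Effective E) (degE≡q : deg E ≡ + q) where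

      f : V m n → ℤ
      f (inj₁ a) = E (inj₁ a) - ((+ q) · P) (inj₁ a)
      f (inj₂ b) = + 0

      ∑f : ∑[ a < m ] f (inj₁ a) ≡ - (∑[ b < n ] E (inj₂ b))
      ∑f = begin
        ∑[ a < m ] (E (inj₁ a) - ((+ q) · P) (inj₁ a))
          ≡⟨ ∑-distrib-- (E ∘ inj₁) (λ a → ((+ q) · P) (inj₁ a)) ⟩
        (∑[ a < m ] E (inj₁ a)) - (∑[ a < m ] ((+ q) · P) (inj₁ a))
          ≡⟨ cong (_-_ (∑[ a < m ] E (inj₁ a))) (trans (∑-·-inj₁ (+ q) i) (trans (sym degE≡q) (deg-split E))) ⟩
        (∑[ a < m ] E (inj₁ a)) - ((∑[ a < m ] E (inj₁ a)) + (∑[ b < n ] E (inj₂ b)))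
          ≡⟨ cancel (∑[ a < m ] E (inj₁ a)) (∑[ b < n ] E (inj₂ b)) ⟩
        - (∑[ b < n ] E (inj₂ b))
          ∎
        where
        open ≡-Reasoning
        cancel : ∀ x y → x - (x + y) ≡ - y
        cancel = solve-∀

      fired-inj₁ : ∀ a → (((+ k) · P) ⊝ E) (inj₁ a) + Δ f (inj₁ a)
                       ≡ (((+ k) · P) (inj₁ a) - + n * ((+ q) · P) (inj₁ a)) + + n' * E (inj₁ a)
      fired-inj₁ a = begin
        (x - E (inj₁ a)) + Δ f (inj₁ a)
          ≡⟨ cong (_+_ (x - E (inj₁ a))) (Δ-inj₁-expand f a) ⟩
        (x - E (inj₁ a)) + (+ n * f (inj₁ a) - (∑[ b < n ] f (inj₂ b)))
          ≡⟨ cong (λ z → (x - E (inj₁ a)) + (+ n * f (inj₁ a) - z)) (sum-replicate-zero n) ⟩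
        (x - E (inj₁ a)) + (+ n * f (inj₁ a) - + 0)
          ≡⟨ regroup x y (E (inj₁ a)) (+ n') ⟩
        (x - + n * y) + + n' * E (inj₁ a)
          ∎
        where
        open ≡-Reasoning
        x y : ℤ
        x = ((+ k) · P) (inj₁ a)
        y = ((+ q) · P) (inj₁ a)
        regroup : ∀ x y e n' → (x - e) + ((+ 1 + n') * (e - y) - + 0) ≡ (x - (+ 1 + n') * y) + n' * e
        regroup = solve-∀

      fired-inj₂ : ∀ b → (((+ k) · P) ⊝ E) (inj₂ b) + Δ f (inj₂ b) ≡ (∑[ b < n ] E (inj₂ b)) - E (inj₂ b)
      fired-inj₂ b = begin
        (((+ k) · P) (inj₂ b) - E (inj₂ b)) + Δ f (inj₂ b)
          ≡⟨ cong (_+_ (((+ k) · P) (inj₂ b) - E (inj₂ b))) (Δ-inj₂-expand f b) ⟩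
        (((+ k) · P) (inj₂ b) - E (inj₂ b)) + (+ m * + 0 - (∑[ a < m ] f (inj₁ a)))
          ≡⟨ cong₂ (λ x y → (x - E (inj₂ b)) + (+ m * + 0 - y)) (·-other (+ k) {P} {inj₂ b} λ ()) ∑f ⟩
        (+ 0 - E (inj₂ b)) + (+ m * + 0 - - (∑[ b < n ] E (inj₂ b)))
          ≡⟨ regroup (∑[ b < n ] E (inj₂ b)) (E (inj₂ b)) (+ m) ⟩
        (∑[ b < n ] E (inj₂ b)) - E (inj₂ b)
          ∎
        where
        open ≡-Reasoning
        regroup : ∀ S e m → (+ 0 - e) + (m * + 0 - - S) ≡ S - e
        regroup = solve-∀

      fired≥0 : Effective (λ Q → (((+ k) · P) ⊝ E) Q + Δ f Q)
      fired≥0 (inj₁ a) = subst (+ 0 ≤_) (sym (fired-inj₁ a))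
                               (ℤP.+-mono-≤ (ℤP.i≤j⇒0≤j-i (n*qP≤kP nq≤k a)) (0≤pos* n' (E≥0 (inj₁ a))))
      fired≥0 (inj₂ b) = subst (+ 0 ≤_) (sym (fired-inj₂ b)) (ℤP.i≤j⇒0≤j-i (∑-nonneg-≥-term (E≥0 ∘ inj₂) b))

    rank-lower : ∀ k q → n ℕ.* q ℕ.≤ k → RankCond ((+ k) · P) q
    rank-lower k q nq≤k E E≥0 degE≡q = firing⇒LinSysNonempty f fired≥0
      where open LowerBound nq≤k E E≥0 degE≡q

    coord : Fin m → Fin m
    coord a = Perm.transpose i Fin.zero ⟨$⟩ʳ a

    coord≡0⇒≡i : ∀ {a} → coord a ≡ Fin.zero → a ≡ i
    coord≡0⇒≡i {a} eq = begin
      a                                              ≡⟨ Perm.inverseˡ (Perm.transpose i Fin.zero) ⟨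
      Perm.transpose i Fin.zero ⟨$⟩ˡ coord a          ≡⟨ cong (Perm.transpose i Fin.zero ⟨$⟩ˡ_) eq ⟩
      PC.transpose Fin.zero i Fin.zero               ≡⟨ transpose-self Fin.zero i ⟩
      i                                              ∎
      where open ≡-Reasoning

    ·P-coord : ∀ c a → (c · P) (inj₁ a) ≡ pointAt0 c (toℕ (coord a))
    ·P-coord c a with coord a in eq
    ... | Fin.zero  = subst (λ x → (c · P) (inj₁ x) ≡ c) (sym (coord≡0⇒≡i eq)) (·-self c P)
    ... | Fin.suc t = ·-other c λ P≡a →
      FinP.0≢1+n (trans (sym (transpose-self i Fin.zero)) (trans (cong coord (inj₁-injective P≡a)) eq))

    ∑-coord : (g : Fin m → ℤ) → ∑[ a < m ] g (coord a) ≡ sum g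
    ∑-coord g = sym (∑-permute g (Perm.transpose i Fin.zero))

    module UpperBound {k e q : ℕ} (q<m' : q ℕ.< m') (k≤ : k ℕ.≤ e ℕ.+ n ℕ.* q ℕ.+ n') where

      E : Divisor m n
      E (inj₁ a) = testDivisor e q (toℕ (coord a))
      E (inj₂ b) = + 0

      h : V m n → ℤ
      h (inj₁ a) = testFiring q (toℕ (coord a))
      h (inj₂ b) = + 0

      D' : Divisor m n
      D' Q = (((+ k) · P) ⊝ E) Q + Δ h Q

      E≥0 : Effective E
      E≥0 (inj₁ a) = testDivisor-nonneg e q (toℕ (coord a))
      E≥0 (inj₂ b) = ℤP.≤-refl

      degE : deg E ≡ + (e ℕ.+ suc q)
      degE = begin
        deg E                                                    ≡⟨ deg-split E ⟩
        (∑[ a < m ] E (inj₁ a)) + (∑[ b < n ] E (inj₂ b))        ≡⟨ cong₂ _+_ (∑-coord (testDivisor e q ∘ toℕ))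
                                                                             (sum-replicate-zero n) ⟩
        (∑[ t < m ] testDivisor e q (toℕ t)) + + 0               ≡⟨ ℤP.+-identityʳ _ ⟩
        ∑[ t < m ] testDivisor e q (toℕ t)                       ≡⟨ ∑-testDivisor e q q<m' ⟩
        + e + + suc q                                            ≡⟨ ℤP.pos-+ e (suc q) ⟨
        + (e ℕ.+ suc q)                                          ∎
        where open ≡-Reasoning

      D'-inj₁ : ∀ a → D' (inj₁ a) ≡ testResult n k e q (toℕ (coord a))
      D'-inj₁ a = cong₂ _+_ (cong (_- E (inj₁ a)) (·P-coord (+ k) a))
                            (trans (Δ-inj₁-expand h a) (cong (_-_ (+ n * h (inj₁ a))) (sum-replicate-zero n)))

      D'-inj₁<n : ∀ a → D' (inj₁ a) < + n
      D'-inj₁<n a = subst (_< + n) (sym (D'-inj₁ a)) (testResult<n n' k e q k≤ (toℕ (coord a)))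

      D'-inj₂≤0 : ∀ b → D' (inj₂ b) ≤ + 0
      D'-inj₂≤0 b = ℤP.≤-reflexive (begin
        D' (inj₂ b)
          ≡⟨ cong₂ _+_ (cong (_- + 0) (·-other (+ k) {P} {inj₂ b} λ ())) (Δ-inj₂-expand h b) ⟩
        (+ 0 - + 0) + (+ m * + 0 - (∑[ a < m ] h (inj₁ a)))
          ≡⟨ cong (λ s → (+ 0 - + 0) + (+ m * + 0 - s)) (trans (∑-coord (testFiring q ∘ toℕ)) (∑-testFiring q q<m')) ⟩
        (+ 0 - + 0) + (+ m * + 0 - + 0)
          ≡⟨ cancel (+ m) ⟩
        + 0 ∎)
        where
        open ≡-Reasoning
        cancel : ∀ x → (+ 0 - + 0) + (x * + 0 - + 0) ≡ + 0
        cancel = solve-∀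

      1<m : 1 ℕ.< m
      1<m = s≤s (ℕP.≤-trans (s≤s z≤n) q<m')

      a₀ : Fin m
      a₀ = Perm.transpose i Fin.zero ⟨$⟩ˡ Fin.fromℕ< 1<m

      D'-a₀<0 : D' (inj₁ a₀) < + 0
      D'-a₀<0 = begin-strict
        D' (inj₁ a₀)                                ≡⟨ D'-inj₁ a₀ ⟩
        testResult n k e q (toℕ (coord a₀))         ≡⟨ cong (testResult n k e q ∘ toℕ)
                                                            (Perm.inverseʳ (Perm.transpose i Fin.zero) {Fin.fromℕ< 1<m}) ⟩
        testResult n k e q (toℕ (Fin.fromℕ< 1<m))   ≡⟨ cong (testResult n k e q) (FinP.toℕ-fromℕ< 1<m) ⟩
        testResult n k e q 1                        ≡⟨ testResult-1 n' k e q ⟩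
        -[1+ 0 ]                                    <⟨ ℤ.-<+ ⟩
        + 0                                         ∎
        where open ℤP.≤-Reasoning

    rank-upper : ∀ k e q → q ℕ.< m' → k ℕ.≤ e ℕ.+ n ℕ.* q ℕ.+ n' → ¬ RankCond ((+ k) · P) (e ℕ.+ suc q)
    rank-upper k e q q<m' k≤ rank≥ =
      LinSysEmpty-criterion D' a₀ D'-a₀<0 D'-inj₂≤0 D'-inj₁<n
        (LinSysNonempty-linEquiv h (λ _ → refl) (rank≥ E E≥0 degE))
      where open UpperBound {k} {e} {q} q<m' k≤

    kP-nonempty : ∀ k → LinSysNonempty ((+ k) · P)
    kP-nonempty k = Effective⇒LinSysNonempty (·-effective (+≤+ z≤n) P)

    IsRank-kP-below : ∀ q ρ → q ℕ.< m' → ρ ℕ.≤ n' → IsRank ((+ (n ℕ.* q ℕ.+ ρ)) · P) (+ q)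
    IsRank-kP-below q ρ q<m' ρ≤n' =
      IsRank-intro P q (kP-nonempty _) (rank-lower _ q (ℕP.m≤m+n (n ℕ.* q) ρ))
                   (rank-upper _ 0 q q<m' (ℕP.+-monoʳ-≤ (n ℕ.* q) ρ≤n'))

    IsRank-kP-above : ∀ j → IsRank ((+ (m' ℕ.* n ℕ.+ j)) · P) (+ (m' ℕ.+ j))
    IsRank-kP-above j = IsRank-intro P (m' ℕ.+ j) (kP-nonempty _) lower upper
      where
      K : ℕ
      K = m' ℕ.* n ℕ.+ j
      lower : RankCond ((+ K) · P) (m' ℕ.+ j)
      lower = RankCond-of-genus {(+ K) · P} (m' ℕ.+ j)
                (ℤP.≤-reflexive (trans (cong +_ (genus-shift m' n' j)) (sym (deg-· (+ K) P))))
      upper : ¬ RankCond ((+ K) · P) (suc (m' ℕ.+ j))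
      upper with m' ℕ.≟ 0
      ... | yes m'≡0 = λ rank≥ → ℕP.1+n≰n (subst (λ x → suc (x ℕ.+ j) ℕ.≤ x ℕ.* n ℕ.+ j) m'≡0
                                   (ℤP.drop‿+≤+ (subst (+ suc (m' ℕ.+ j) ≤_) (deg-· (+ K) P) (RankCond⇒≤deg P {(+ K) · P} rank≥))))
      ... | no  m'≢0 = subst (λ r → ¬ RankCond ((+ K) · P) r) rank≡
                         (rank-upper K (suc j) (ℕ.pred m') pred<m' (ℕP.≤-reflexive K≡))
        where
        suc-pred : suc (ℕ.pred m') ≡ m'
        suc-pred = ℕP.suc-pred m' ⦃ ℕ.≢-nonZero m'≢0 ⦄
        pred<m' : ℕ.pred m' ℕ.< m'
        pred<m' = subst (ℕ.pred m' ℕ.<_) suc-pred (ℕP.n<1+n _)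
        K≡ : K ≡ suc j ℕ.+ n ℕ.* ℕ.pred m' ℕ.+ n'
        K≡ = subst (λ x → x ℕ.* n ℕ.+ j ≡ suc j ℕ.+ n ℕ.* ℕ.pred m' ℕ.+ n') suc-pred (degree-shift (ℕ.pred m') n' j)
        rank≡ : suc j ℕ.+ suc (ℕ.pred m') ≡ suc (m' ℕ.+ j)
        rank≡ = trans (cong (suc j ℕ.+_) suc-pred) (cong suc (ℕP.+-comm j m'))

data DegreeView (m' n' : ℕ) : ℕ → Set where
  below : ∀ q ρ → q ℕ.< m' → ρ ℕ.≤ n' → DegreeView m' n' (suc n' ℕ.* q ℕ.+ ρ)
  above : ∀ j → DegreeView m' n' (m' ℕ.* suc n' ℕ.+ j)

degreeView : ∀ m' n' k → DegreeView m' n' k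
degreeView m' n' k with k ℕ.<? m' ℕ.* suc n'
... | yes k<g = subst (DegreeView m' n') (sym k≡)
                      (below (k / suc n') (k % suc n') (ℕDM.m<n*o⇒m/o<n k<g) (ℕP.≤-pred (ℕDM.m%n<n k (suc n'))))
  where
  k≡ : k ≡ suc n' ℕ.* (k / suc n') ℕ.+ k % suc n'
  k≡ = trans (ℕDM.m≡m%n+[m/n]*n k (suc n'))
             (trans (ℕP.+-comm (k % suc n') _) (cong (ℕ._+ k % suc n') (ℕP.*-comm (k / suc n') (suc n'))))
... | no  k≮g = subst (DegreeView m' n') (ℕP.m+[n∸m]≡n (ℕP.≮⇒≥ k≮g)) (above (k ℕ.∸ m' ℕ.* suc n'))

next-multiple : ∀ n' q → suc (suc n' ℕ.* q ℕ.+ n') ≡ suc n' ℕ.* suc q ℕ.+ 0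
next-multiple = ℕSolver.solve-∀

¬InTarget-between : ∀ m' n' q ρ → q ℕ.< m' → ρ ℕ.< n' → ¬ InTarget (suc m') (suc n') (suc (suc n' ℕ.* q ℕ.+ ρ))
¬InTarget-between m' n' q ρ q<m' ρ<n' (inj₁ (t , k≡nt)) = ℕP.0≢1+n (begin
  0                                ≡⟨ ℕDM.m*n%n≡0 t (suc n') ⟨
  t ℕ.* suc n' % suc n'            ≡⟨ cong (_% suc n') (trans (ℕP.*-comm t (suc n')) (sym k≡nt)) ⟩
  suc (suc n' ℕ.* q ℕ.+ ρ) % suc n' ≡⟨ cong (_% suc n') (reorder n' q ρ) ⟩
  (suc ρ ℕ.+ q ℕ.* suc n') % suc n' ≡⟨ ℕDM.[m+kn]%n≡m%n (suc ρ) q (suc n') ⟩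
  suc ρ % suc n'                   ≡⟨ ℕDM.m<n⇒m%n≡m (s≤s ρ<n') ⟩
  suc ρ                            ∎)
  where
  open ≡-Reasoning
  reorder : ∀ n' q ρ → suc (suc n' ℕ.* q ℕ.+ ρ) ≡ suc ρ ℕ.+ q ℕ.* suc n'
  reorder = ℕSolver.solve-∀
¬InTarget-between m' n' q ρ q<m' ρ<n' (inj₂ (t , k≡g+t)) = ℕP.<-irrefl k≡g+t (begin-strict
  suc (suc n' ℕ.* q ℕ.+ ρ)   ≡⟨ ℕP.+-suc (suc n' ℕ.* q) ρ ⟨
  suc n' ℕ.* q ℕ.+ suc ρ     <⟨ ℕP.+-monoʳ-< (suc n' ℕ.* q) (s≤s ρ<n') ⟩
  suc n' ℕ.* q ℕ.+ suc n'    ≡⟨ trans (ℕP.+-comm (suc n' ℕ.* q) (suc n')) (sym (ℕP.*-suc (suc n') q)) ⟩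
  suc n' ℕ.* suc q           ≤⟨ ℕP.*-monoʳ-≤ (suc n') q<m' ⟩
  suc n' ℕ.* m'              ≡⟨ ℕP.*-comm (suc n') m' ⟩
  m' ℕ.* suc n'              ≤⟨ ℕP.m≤m+n (m' ℕ.* suc n') t ⟩
  m' ℕ.* suc n' ℕ.+ t        ∎)
  where open ℕP.≤-Reasoning

module _ {m' n' : ℕ} (i : Fin (suc m')) where

  private
    m n : ℕ
    m = suc m'
    n = suc n'
    P : V m n
    P = inj₁ i

  rankAt : ∀ {k} → DegreeView m' n' k → ℕ
  rankAt (below q _ _ _) = q
  rankAt (above j)       = m' ℕ.+ j

  IsRank-kP : ∀ {k} (v : DegreeView m' n' k) → IsRank ((+ k) · P) (+ rankAt v)
  IsRank-kP (below q ρ q<m' ρ≤n') = IsRank-kP-below i q ρ q<m' ρ≤n'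
  IsRank-kP (above j)             = IsRank-kP-above i j

  ¬InHr-of-equal-ranks : ∀ {k r} → IsRank ((+ k) · P) r → IsRank ((+ k - + 1) · P) r → ¬ InHr P k
  ¬InHr-of-equal-ranks R R' (r₁ , r₂ , R₁ , R₂ , r₂<r₁) =
    ℤP.<-irrefl (trans (IsRank-unique R₂ R') (IsRank-unique R R₁)) r₂<r₁

  InHr⇒InTarget : ∀ k → InHr P k → InTarget m n k
  InHr⇒InTarget k jump with degreeView m' n' k
  ... | above j                   = inj₂ (j , refl)
  ... | below q zero _ _          = inj₁ (q , ℕP.+-identityʳ (n ℕ.* q))
  ... | below q (suc ρ) q<m' ρ<n' = contradiction jump (¬InHr-of-equal-ranks (IsRank-kP-below i q (suc ρ) q<m' ρ<n')
          (subst (λ c → IsRank (c · P) (+ q)) (cong (λ x → + x - + 1) (sym (ℕP.+-suc (n ℕ.* q) ρ)))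
                 (IsRank-kP-below i q ρ q<m' (ℕP.<⇒≤ ρ<n'))))

  InTarget⇒InHr : ∀ k → InTarget m n k → InHr P k
  InTarget⇒InHr zero _ = _ , -[1+ 0 ] , IsRank-kP (degreeView m' n' 0) ,
                          IsRank-negative (ℤP.≤-<-trans (ℤP.≤-reflexive (deg-· -[1+ 0 ] P)) ℤ.-<+) , ℤ.-<+
  InTarget⇒InHr (suc k) target with degreeView m' n' k
  ... | above j = _ , _ , subst (λ x → IsRank ((+ x) · P) (+ (m' ℕ.+ suc j))) (ℕP.+-suc (m' ℕ.* n) j) (IsRank-kP-above i (suc j)) ,
                  IsRank-kP-above i j , +<+ (ℕP.≤-reflexive (sym (ℕP.+-suc m' j)))
  ... | below q ρ q<m' ρ≤n' with ℕP.m≤n⇒m<n∨m≡n ρ≤n'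
  ...   | inj₁ ρ<n' = contradiction target (¬InTarget-between m' n' q ρ q<m' ρ<n')
  ...   | inj₂ refl with ℕP.m≤n⇒m<n∨m≡n q<m'
  ...     | inj₁ q+1<m' = _ , _ , subst (λ x → IsRank ((+ x) · P) (+ suc q)) (sym (next-multiple n' q))
                                         (IsRank-kP-below i (suc q) 0 q+1<m' z≤n) ,
                          IsRank-kP-below i q n' q<m' ℕP.≤-refl , +<+ ℕP.≤-refl
  ...     | inj₂ q+1≡m' = _ , _ , subst (λ x → IsRank ((+ x) · P) (+ (m' ℕ.+ 0))) (sym k+1≡)
                                         (IsRank-kP-above i 0) ,
                          IsRank-kP-below i q n' q<m' ℕP.≤-refl , +<+ (ℕP.≤-reflexive (trans q+1≡m' (sym (ℕP.+-identityʳ m'))))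
    where
    k+1≡ : suc (n ℕ.* q ℕ.+ n') ≡ m' ℕ.* n ℕ.+ 0
    k+1≡ = trans (next-multiple n' q) (cong (ℕ._+ 0) (trans (cong (n ℕ.*_) q+1≡m') (ℕP.*-comm n m')))

corollary3p10 : (m n : ℕ) → 1 ℕ.≤ m → 1 ℕ.≤ n → (i : Fin m) → (k : ℕ) →
    (InHr {m} {n} (inj₁ i) k → InTarget m n k) × (InTarget m n k → InHr {m} {n} (inj₁ i) k)
corollary3p10 (suc m') (suc n') _ _ i k = InHr⇒InTarget i k , InTarget⇒InHr i k
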